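{- If $\mathbf v\in\mathbb V$ and $\vdash\mathbf v:T$ is derivable in $\lambda^{\mathrm{vec}}_{\mathrm R}$ (empty context), then $\|T\|=\|\mathbf v\|$.
   Context: Fix a commutative ring $(\mathsf S,+,\times)$ of scalars. Terms: $\mathbf t ::= x\mid \lambda x.\mathbf t\mid (\mathbf t)\,\mathbf t\mid \alpha\cdot\mathbf t\mid \mathbf t+\mathbf t$; basis terms $\mathbf b::=x\mid\lambda x.\mathbf t$. $\mathbb V=\{\sum_{i=1}^n\alpha_i\cdot\lambda x_i.\mathbf t_i+\sum_{j=n+1}^m\lambda x_j.\mathbf t_j \mid \lambda x_i.\mathbf t_i\neq\lambda x_j.\mathbf t_j\text{ for all }i,j\}$. Types: general $T::=U\mid\alpha\cdot T\mid T+T\mid\mathbb X$, unit $U::=X\mid U\to T\mid\forall X.U\mid\forall\mathbb X.U$ ($X$ unit type variables, $\mathbb X$ general type variables). $\equiv$ is the smallest congruence with $1\cdot T\equiv T$, $\alpha\cdot(\beta\cdot T)\equiv(\alpha\times\beta)\cdot T$, $\alpha\cdot T+\alpha\cdot R\equiv\alpha\cdot(T+R)$, $\alpha\cdot T+\beta\cdot T\equiv(\alpha+\beta)\cdot T$, $T+R\equiv R+T$, $T+(R+S)\equiv(T+R)+S$. In $T[A/X]$, $A$ is unit when $X$ is a unit variable. Typing rules (contexts: finite sets of $x:U$, $U$ unit): (ax) $\Gamma,x:U\vdash x:U$; ($\equiv$) from $\Gamma\vdash\mathbf t:T$, $R\equiv T$ infer $\Gamma\vdash\mathbf t:R$; ($\to_I$)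 from $\Gamma,x:U\vdash\mathbf t:T$ infer $\Gamma\vdash\lambda x.\mathbf t:U\to T$; ($\to_E$) from $\Gamma\vdash\mathbf t:\sum_{i=1}^n\alpha_i\cdot\forall\vec X.(U\to T_i)$ and $\Gamma\vdash\mathbf r:\sum_{j=1}^m\beta_j\cdot U[\vec A_j/\vec X]$ infer $\Gamma\vdash(\mathbf t)\,\mathbf r:\sum_{i}\sum_{j}(\alpha_i\times\beta_j)\cdot T_i[\vec A_j/\vec X]$; ($\forall_I$) from $\Gamma\vdash\mathbf t:\sum_i\alpha_i\cdot U_i$, $X\notin FV(\Gamma)$ infer $\Gamma\vdash\mathbf t:\sum_i\alpha_i\cdot\forall X.U_i$; ($\forall_E$) from $\Gamma\vdash\mathbf t:\sum_i\alpha_i\cdot\forall X.U_i$ infer $\Gamma\vdash\mathbf t:\sum_i\alpha_i\cdot U_i[A/X]$; ($+_I$) from $\Gamma\vdash\mathbf t:T$, $\Gamma\vdash\mathbf r:R$ infer $\Gamma\vdash\mathbf t+\mathbf r:T+R$; ($1_E$) from $\Gamma\vdash1\cdot\mathbf t:T$ infer $\Gamma\vdash\mathbf t:T$; ($S$) from $\Gamma\vdash\mathbf t:T_i$ for all $i$ infer $\Gamma\vdash(\sum_i\alpha_i)\cdot\mathbf t:\sum_i\alpha_i\cdot T_i$. Weight of types: $\|U\|=1$ for unit types, $\|\alpha\cdot T\|=\alpha\cdot\|T\|$, $\|T+R\|=\|T\|+\|R\|$. Weight of terms: $\|\mathbf b\|=1$ for basis terms, $\|\alpha\cdot\mathbf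 t\|=\alpha\cdot\|\mathbf t\|$, $\|\mathbf t+\mathbf r\|=\|\mathbf t\|+\|\mathbf r\|$. -}

module Defs where

open import Level using (Level; _⊔_)
open import Algebra.Bundles using (CommutativeRing)
open import Data.Nat as ℕ using (ℕ; zero; suc)
open import Data.List using (List; []; _∷_; map; _++_)
import Data.List
open import Data.List.NonEmpty as L⁺ using (List⁺; _∷_; concatMap)
open import Data.List.Relation.Unary.All using (All)
open import Data.List.Relation.Unary.Unique.Propositional using (Unique)
open import Data.List.Membership.Propositional using (_∈_)
open import Data.Product using (_×_; _,_; proj₁; proj₂; Σ)
open import Relation.Binary.PropositionalEquality using (_≡_)

-- Term variables and type variables are de Bruijn indices (terms and
-- types are taken up to α-equivalence).  Type variables come in two
-- kinds: unit variables X and general variables 𝕏, each kind with its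
-- own de Bruijn index space.

module Lang {c ℓ : Level} (R : CommutativeRing c ℓ) where

  open CommutativeRing R using (Carrier; _≈_; 0#; 1#)
    renaming (_+_ to _+ᴿ_; _*_ to _*ᴿ_)

  S : Set c
  S = Carrier

  sumS' : S → List S → S
  sumS' α []        = α
  sumS' α (β ∷ αs)  = α +ᴿ sumS' β αs

  sumS : List⁺ S → S
  sumS (α ∷ αs) = sumS' α αs

  infixl 7 _·_
  infixl 6 _⊕_

  data Term : Set c where
    var  : ℕ → Term
    ƛ    : Term → Term
    app  : Term → Term → Term
    _·_  : S → Term → Term
    _⊕_  : Term → Term → Term

  -- The set 𝕍: sums (any bracketing / order) of summands α·λx.t or
  -- λx.t, at least one summand, all abstractions pairwise distinct.
  -- `VSum v ls` says v is such a sum whose list of abstractions is ls.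
  data VSum : Term → List Term → Set c where
    scaled : ∀ α t → VSum (α · ƛ t) (ƛ t ∷ [])
    plain  : ∀ t → VSum (ƛ t) (ƛ t ∷ [])
    plus   : ∀ {v w ls ks} → VSum v ls → VSum w ks → VSum (v ⊕ w) (ls ++ ks)

  InV : Term → Set c
  InV v = Σ (List Term) λ ls → VSum v ls × Unique ls

  data TermWeight : Term → S → Set c where
    w-var : ∀ x → TermWeight (var x) 1#
    w-lam : ∀ t → TermWeight (ƛ t) 1#
    w-scl : ∀ {α t w} → TermWeight t w → TermWeight (α · t) (α *ᴿ w)
    w-sum : ∀ {t r w w'} → TermWeight t w → TermWeight r w' →
            TermWeight (t ⊕ r) (w +ᴿ w')

  data Kind : Set where
    unitK genK : Kind

  infixr 5 _⇒_
  infixl 7 _•_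
  infixl 6 _⊞_

  mutual
    data UType : Set c where
      tvar : ℕ → UType
      _⇒_  : UType → GType → UType
      ∀[_] : Kind → UType → UType

    data GType : Set c where
      ⌜_⌝  : UType → GType
      _•_  : S → GType → GType
      _⊞_  : GType → GType → GType
      gvar : ℕ → GType

  ext : (ℕ → ℕ) → ℕ → ℕ
  ext ρ zero    = zero
  ext ρ (suc n) = suc (ρ n)

  mutual
    renU : (ℕ → ℕ) → (ℕ → ℕ) → UType → UType
    renU ρ σ (tvar n)       = tvar (ρ n)
    renU ρ σ (U ⇒ T)        = renU ρ σ U ⇒ renG ρ σ T
    renU ρ σ (∀[ unitK ] U) = ∀[ unitK ] (renU (ext ρ) σ U)
    renU ρ σ (∀[ genK ] U)  = ∀[ genK ] (renU ρ (ext σ) U)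

    renG : (ℕ → ℕ) → (ℕ → ℕ) → GType → GType
    renG ρ σ ⌜ U ⌝    = ⌜ renU ρ σ U ⌝
    renG ρ σ (α • T)  = α • renG ρ σ T
    renG ρ σ (T ⊞ T') = renG ρ σ T ⊞ renG ρ σ T'
    renG ρ σ (gvar n) = gvar (σ n)

  wkU : Kind → UType → UType
  wkU unitK = renU suc (λ n → n)
  wkU genK  = renU (λ n → n) suc

  wkG : Kind → GType → GType
  wkG unitK = renG suc (λ n → n)
  wkG genK  = renG (λ n → n) suc

  record Sub : Set c where
    constructor ⟨_,_⟩
    field
      su : ℕ → UType
      sg : ℕ → GType
  open Sub

  liftS : Kind → Sub → Sub
  liftS unitK ⟨ f , g ⟩ =
    ⟨ (λ { zero → tvar zero ; (suc n) → wkU unitK (f n) }) , (λ n → wkG unitK (g n)) ⟩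
  liftS genK ⟨ f , g ⟩ =
    ⟨ (λ n → wkU genK (f n)) , (λ { zero → gvar zero ; (suc n) → wkG genK (g n) }) ⟩

  mutual
    subU : Sub → UType → UType
    subU s (tvar n)     = su s n
    subU s (U ⇒ T)      = subU s U ⇒ subG s T
    subU s (∀[ k ] U)   = ∀[ k ] (subU (liftS k s) U)

    subG : Sub → GType → GType
    subG s ⌜ U ⌝    = ⌜ subU s U ⌝
    subG s (α • T)  = α • subG s T
    subG s (T ⊞ T') = subG s T ⊞ subG s T'
    subG s (gvar n) = sg s n

  Arg : Kind → Set c
  Arg unitK = UType
  Arg genK  = GType

  single : (k : Kind) → Arg k → Sub
  single unitK A = ⟨ (λ { zero → A ; (suc n) → tvar n }) , gvar ⟩
  single genK  A = ⟨ tvar , (λ { zero → A ; (suc n) → gvar n }) ⟩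

  ∀⃗ : List Kind → UType → UType
  ∀⃗ []       U = U
  ∀⃗ (k ∷ ks) U = ∀[ k ] (∀⃗ ks U)

  data Args : List Kind → Set c where
    []  : Args []
    _∷_ : ∀ {k ks} → Arg k → Args ks → Args (k ∷ ks)

  liftMany : List Kind → Sub → Sub
  liftMany []       s = s
  liftMany (k ∷ ks) s = liftMany ks (liftS k s)

  instU : ∀ {ks} → Args ks → UType → UType
  instU {[]}     []       U = U
  instU {k ∷ ks} (A ∷ As) U = instU As (subU (liftMany ks (single k A)) U)

  instG : ∀ {ks} → Args ks → GType → GType
  instG {[]}     []       T = T
  instG {k ∷ ks} (A ∷ As) T = instG As (subG (liftMany ks (single k A)) T)

  ΣT' : S × GType → List (S × GType) → GType
  ΣT' (α , T) []        = α • T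
  ΣT' (α , T) (p ∷ ps)  = α • T ⊞ ΣT' p ps

  ΣT : List⁺ (S × GType) → GType
  ΣT (p ∷ ps) = ΣT' p ps

  infix 4 _≅U_ _≅G_
  mutual
    data _≅U_ : UType → UType → Set (c ⊔ ℓ) where
      reflU  : ∀ {U} → U ≅U U
      symU   : ∀ {U V} → U ≅U V → V ≅U U
      transU : ∀ {U V W} → U ≅U V → V ≅U W → U ≅U W
      ⇒-cong : ∀ {U U' T T'} → U ≅U U' → T ≅G T' → (U ⇒ T) ≅U (U' ⇒ T')
      ∀-cong : ∀ {k U U'} → U ≅U U' → ∀[ k ] U ≅U ∀[ k ] U'

    data _≅G_ : GType → GType → Set (c ⊔ ℓ) where
      reflG  : ∀ {T} → T ≅G T
      symG   : ∀ {T R} → T ≅G R → R ≅G T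
      transG : ∀ {T R Q} → T ≅G R → R ≅G Q → T ≅G Q
      ⌜⌝-cong : ∀ {U U'} → U ≅U U' → ⌜ U ⌝ ≅G ⌜ U' ⌝
      •-cong : ∀ {α T T'} → T ≅G T' → α • T ≅G α • T'
      ⊞-cong : ∀ {T T' R R'} → T ≅G T' → R ≅G R' → T ⊞ R ≅G T' ⊞ R'
      ax-one   : ∀ {T} → 1# • T ≅G T
      ax-mul   : ∀ {α β T} → α • (β • T) ≅G (α *ᴿ β) • T
      ax-dist  : ∀ {α T R} → α • T ⊞ α • R ≅G α • (T ⊞ R)
      ax-fact  : ∀ {α β T} → α • T ⊞ β • T ≅G (α +ᴿ β) • T
      ax-comm  : ∀ {T R} → T ⊞ R ≅G R ⊞ T
      ax-assoc : ∀ {T R Q} → T ⊞ (R ⊞ Q) ≅G (T ⊞ R) ⊞ Q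

  data TypeWeight : GType → S → Set c where
    w-unit : ∀ U → TypeWeight ⌜ U ⌝ 1#
    w-scl  : ∀ {α T w} → TypeWeight T w → TypeWeight (α • T) (α *ᴿ w)
    w-sum  : ∀ {T R w w'} → TypeWeight T w → TypeWeight R w' →
             TypeWeight (T ⊞ R) (w +ᴿ w')

  Ctx : Set c
  Ctx = List UType

  data _∋_∶_ : Ctx → ℕ → UType → Set c where
    here  : ∀ {Γ U} → (U ∷ Γ) ∋ zero ∶ U
    there : ∀ {Γ U V n} → Γ ∋ n ∶ U → (V ∷ Γ) ∋ suc n ∶ U

  infix 3 _⊢_∶_
  data _⊢_∶_ : Ctx → Term → GType → Set (c ⊔ ℓ) where
    ax  : ∀ {Γ x U} → Γ ∋ x ∶ U → Γ ⊢ var x ∶ ⌜ U ⌝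
    eqv : ∀ {Γ t T R} → Γ ⊢ t ∶ T → R ≅G T → Γ ⊢ t ∶ R
    →I  : ∀ {Γ t U T} → (U ∷ Γ) ⊢ t ∶ T → Γ ⊢ ƛ t ∶ ⌜ U ⇒ T ⌝
    →E  : ∀ {Γ t r ks U}
            (αT : List⁺ (S × GType)) (βA : List⁺ (S × Args ks)) →
          Γ ⊢ t ∶ ΣT (L⁺.map (λ p → proj₁ p , ⌜ ∀⃗ ks (U ⇒ proj₂ p) ⌝) αT) →
          Γ ⊢ r ∶ ΣT (L⁺.map (λ q → proj₁ q , ⌜ instU (proj₂ q) U ⌝) βA) →
          Γ ⊢ app t r ∶
            ΣT (concatMap (λ p → L⁺.map (λ q → (proj₁ p *ᴿ proj₁ q) ,
                                              instG (proj₂ q) (proj₂ p)) βA) αT)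
    -- X ∉ FV(Γ): the premise lives under one more binder of kind k,
    -- with Γ weakened accordingly
    ∀I  : ∀ {Γ t k} (αU : List⁺ (S × UType)) →
          Data.List.map (wkU k) Γ ⊢ t ∶ ΣT (L⁺.map (λ p → proj₁ p , ⌜ proj₂ p ⌝) αU) →
          Γ ⊢ t ∶ ΣT (L⁺.map (λ p → proj₁ p , ⌜ ∀[ k ] (proj₂ p) ⌝) αU)
    ∀E  : ∀ {Γ t k} (αU : List⁺ (S × UType)) (A : Arg k) →
          Γ ⊢ t ∶ ΣT (L⁺.map (λ p → proj₁ p , ⌜ ∀[ k ] (proj₂ p) ⌝) αU) →
          Γ ⊢ t ∶ ΣT (L⁺.map (λ p → proj₁ p , ⌜ subU (single k A) (proj₂ p) ⌝) αU)
    +I  : ∀ {Γ t r T R} → Γ ⊢ t ∶ T → Γ ⊢ r ∶ R → Γ ⊢ t ⊕ r ∶ T ⊞ R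
    1E  : ∀ {Γ t T} → Γ ⊢ 1# · t ∶ T → Γ ⊢ t ∶ T
    SR  : ∀ {Γ t} (αT : List⁺ (S × GType)) →
          All (λ p → Γ ⊢ t ∶ proj₂ p) (L⁺.toList αT) →
          Γ ⊢ sumS (L⁺.map proj₁ αT) · t ∶ ΣT αT

module Submission where

open import Defs
open import Level using (Level; _⊔_)
open import Algebra.Bundles using (CommutativeRing)
open import Data.List using (List; []; _∷_)
import Data.List as List
open import Data.List.NonEmpty as L⁺ using (List⁺; _∷_)
open import Data.List.Relation.Unary.All using (All; []; _∷_)
open import Data.Product using (Σ; _×_; _,_; proj₁; proj₂)
open import Relation.Binary.PropositionalEquality as P using (_≡_)

-- A value contains no application, so the elimination rule →E
-- never occurs in its typing derivation, and every remaining rule preserves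
-- the weight: the axioms of ≡ are ring laws, the ∀ rules only change unit
-- types (each of weight 1), and the rule S types every copy of the same term,
-- whose weight is unique, so distributivity applies. The argument works in
-- any context, for every linear combination of basis terms.

module WeightPreservation {c ℓ : Level} (R : CommutativeRing c ℓ) where
  open Lang R
  open CommutativeRing R

  data LinComb : Term → Set c where
    var : ∀ x → LinComb (var x)
    ƛ   : ∀ t → LinComb (ƛ t)
    _·_ : ∀ α {t} → LinComb t → LinComb (α · t)
    _⊕_ : ∀ {t r} → LinComb t → LinComb r → LinComb (t ⊕ r)

  VSum⇒LinComb : ∀ {v ls} → VSum v ls → LinComb v
  VSum⇒LinComb (scaled α t) = α · ƛ t
  VSum⇒LinComb (plain t)    = ƛ t
  VSum⇒LinComb (plus v w)   = VSum⇒LinComb v ⊕ VSum⇒LinComb w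

  TypeWeight-functional : ∀ {T w w'} → TypeWeight T w → TypeWeight T w' → w ≡ w'
  TypeWeight-functional (w-unit U)  (w-unit .U)   = P.refl
  TypeWeight-functional (w-scl p)   (w-scl q)     = P.cong (_ *_) (TypeWeight-functional p q)
  TypeWeight-functional (w-sum p q) (w-sum p' q') =
    P.cong₂ _+_ (TypeWeight-functional p p') (TypeWeight-functional q q')

  TermWeight-functional : ∀ {t w w'} → TermWeight t w → TermWeight t w' → w ≡ w'
  TermWeight-functional (w-var x)   (w-var .x)    = P.refl
  TermWeight-functional (w-lam t)   (w-lam .t)    = P.refl
  TermWeight-functional (w-scl p)   (w-scl q)     = P.cong (_ *_) (TermWeight-functional p q)
  TermWeight-functional (w-sum p q) (w-sum p' q') =
    P.cong₂ _+_ (TermWeight-functional p p') (TermWeight-functional q q')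

  TypeWeight≈ : GType → S → Set (c ⊔ ℓ)
  TypeWeight≈ T u = Σ S λ w → TypeWeight T w × w ≈ u

  exact : ∀ {T w} → TypeWeight T w → TypeWeight≈ T w
  exact p = _ , p , refl

  mutual
    ≅G-preserves-weight : ∀ {T T' w} → T ≅G T' → TypeWeight T w → TypeWeight≈ T' w
    ≅G-preserves-weight reflG          p = exact p
    ≅G-preserves-weight (symG e)       p = ≅G-reflects-weight e p
    ≅G-preserves-weight (transG e₁ e₂) p with ≅G-preserves-weight e₁ p
    ... | _ , p₁ , q₁ with ≅G-preserves-weight e₂ p₁
    ... | _ , p₂ , q₂ = _ , p₂ , trans q₂ q₁
    ≅G-preserves-weight (⌜⌝-cong _)    (w-unit _) = exact (w-unit _)
    ≅G-preserves-weight (•-cong e)     (w-scl p) with ≅G-preserves-weight e p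
    ... | _ , p₁ , q₁ = _ , w-scl p₁ , *-congˡ q₁
    ≅G-preserves-weight (⊞-cong e₁ e₂) (w-sum p q)
      with ≅G-preserves-weight e₁ p | ≅G-preserves-weight e₂ q
    ... | _ , p₁ , q₁ | _ , p₂ , q₂ = _ , w-sum p₁ p₂ , +-cong q₁ q₂
    ≅G-preserves-weight ax-one (w-scl p) =
      _ , p , sym (*-identityˡ _)
    ≅G-preserves-weight ax-mul (w-scl (w-scl p)) =
      _ , w-scl p , *-assoc _ _ _
    ≅G-preserves-weight ax-dist (w-sum (w-scl p) (w-scl q)) =
      _ , w-scl (w-sum p q) , distribˡ _ _ _
    ≅G-preserves-weight ax-fact (w-sum (w-scl p) (w-scl q))
      with TypeWeight-functional p q
    ... | P.refl = _ , w-scl p , distribʳ _ _ _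
    ≅G-preserves-weight ax-comm (w-sum p q) =
      _ , w-sum q p , +-comm _ _
    ≅G-preserves-weight ax-assoc (w-sum p (w-sum q r)) =
      _ , w-sum (w-sum p q) r , +-assoc _ _ _

    ≅G-reflects-weight : ∀ {T T' w} → T ≅G T' → TypeWeight T' w → TypeWeight≈ T w
    ≅G-reflects-weight reflG          p = exact p
    ≅G-reflects-weight (symG e)       p = ≅G-preserves-weight e p
    ≅G-reflects-weight (transG e₁ e₂) p with ≅G-reflects-weight e₂ p
    ... | _ , p₁ , q₁ with ≅G-reflects-weight e₁ p₁
    ... | _ , p₂ , q₂ = _ , p₂ , trans q₂ q₁
    ≅G-reflects-weight (⌜⌝-cong _)    (w-unit _) = exact (w-unit _)
    ≅G-reflects-weight (•-cong e)     (w-scl p) with ≅G-reflects-weight e p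
    ... | _ , p₁ , q₁ = _ , w-scl p₁ , *-congˡ q₁
    ≅G-reflects-weight (⊞-cong e₁ e₂) (w-sum p q)
      with ≅G-reflects-weight e₁ p | ≅G-reflects-weight e₂ q
    ... | _ , p₁ , q₁ | _ , p₂ , q₂ = _ , w-sum p₁ p₂ , +-cong q₁ q₂
    ≅G-reflects-weight ax-one p =
      _ , w-scl p , *-identityˡ _
    ≅G-reflects-weight ax-mul (w-scl p) =
      _ , w-scl (w-scl p) , sym (*-assoc _ _ _)
    ≅G-reflects-weight ax-dist (w-scl (w-sum p q)) =
      _ , w-sum (w-scl p) (w-scl q) , sym (distribˡ _ _ _)
    ≅G-reflects-weight ax-fact (w-scl p) =
      _ , w-sum (w-scl p) (w-scl p) , sym (distribʳ _ _ _)
    ≅G-reflects-weight ax-comm (w-sum p q) =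
      _ , w-sum q p , +-comm _ _
    ≅G-reflects-weight ax-assoc (w-sum (w-sum p q) r) =
      _ , w-sum p (w-sum q r) , sym (+-assoc _ _ _)

  unitSum : (S × UType → UType) → List⁺ (S × UType) → GType
  unitSum f αU = ΣT (L⁺.map (λ p → proj₁ p , ⌜ f p ⌝) αU)

  unitSum-weight : ∀ f (αU : List⁺ (S × UType)) →
    TypeWeight (unitSum f αU) (sumS (L⁺.map (λ p → proj₁ p * 1#) αU))
  unitSum-weight f (p ∷ ps) = go p ps
    where
    go : ∀ p ps →
      TypeWeight (ΣT' (proj₁ p , ⌜ f p ⌝) (List.map (λ q → proj₁ q , ⌜ f q ⌝) ps))
                 (sumS' (proj₁ p * 1#) (List.map (λ q → proj₁ q * 1#) ps))
    go p []        = w-scl (w-unit _)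
    go p (p' ∷ ps) = w-sum (w-scl (w-unit _)) (go p' ps)

  unitSum-weight-independent : ∀ f g (αU : List⁺ (S × UType)) {u} →
    TypeWeight≈ (unitSum f αU) u → TypeWeight≈ (unitSum g αU) u
  unitSum-weight-independent f g αU (_ , tw , q)
    rewrite TypeWeight-functional tw (unitSum-weight f αU) = _ , unitSum-weight g αU , q

  TypeWeight≈-resp : ∀ {T u u'} → u ≈ u' → TypeWeight≈ T u → TypeWeight≈ T u'
  TypeWeight≈-resp e (w , tw , q) = w , tw , trans q e

  scaledSum-weight : ∀ {u} p ps → All (λ q → TypeWeight≈ (proj₂ q) u) (p ∷ ps) →
    TypeWeight≈ (ΣT' p ps) (sumS' (proj₁ p) (List.map proj₁ ps) * u)
  scaledSum-weight (α , _) [] ((_ , tw , q) ∷ []) = _ , w-scl tw , *-congˡ q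
  scaledSum-weight {u} (α , _) (p ∷ ps) ((_ , tw , q) ∷ rest)
    with scaledSum-weight p ps rest
  ... | _ , tw' , q' =
    _ , w-sum (w-scl tw) tw' , trans (+-cong (*-congˡ q) q') (sym (distribʳ u α _))

  mutual
    typed-LinComb-weight : ∀ {Γ v T} → Γ ⊢ v ∶ T → LinComb v →
      Σ S λ u → TermWeight v u × TypeWeight≈ T u
    typed-LinComb-weight (ax _)  (var x) = _ , w-var x , exact (w-unit _)
    typed-LinComb-weight (→I _)  (ƛ t)   = _ , w-lam t , exact (w-unit _)
    typed-LinComb-weight (→E _ _ _ _) ()
    typed-LinComb-weight (eqv d e) v with typed-LinComb-weight d v
    ... | u , tm , (_ , tw , q) = u , tm , TypeWeight≈-resp q (≅G-reflects-weight e tw)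
    typed-LinComb-weight (∀I {k = k} αU d) v with typed-LinComb-weight d v
    ... | u , tm , tw =
      u , tm , unitSum-weight-independent proj₂ (λ p → ∀[ k ] (proj₂ p)) αU tw
    typed-LinComb-weight (∀E {k = k} αU A d) v with typed-LinComb-weight d v
    ... | u , tm , tw =
      u , tm , unitSum-weight-independent (λ p → ∀[ k ] (proj₂ p))
                                          (λ p → subU (single k A) (proj₂ p)) αU tw
    typed-LinComb-weight (+I d₁ d₂) (v₁ ⊕ v₂)
      with typed-LinComb-weight d₁ v₁ | typed-LinComb-weight d₂ v₂
    ... | _ , tm₁ , (_ , tw₁ , q₁) | _ , tm₂ , (_ , tw₂ , q₂) =
      _ , w-sum tm₁ tm₂ , (_ , w-sum tw₁ tw₂ , +-cong q₁ q₂)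
    typed-LinComb-weight (1E d) v with typed-LinComb-weight d (1# · v)
    ... | _ , w-scl tm , tw = _ , tm , TypeWeight≈-resp (*-identityˡ _) tw
    typed-LinComb-weight (SR (p ∷ ps) ds) (_ · v) with typed-LinComb-weights ds v
    ... | u , tm , tws = _ , w-scl tm , scaledSum-weight p ps tws

    typed-LinComb-weights : ∀ {Γ t p ps} →
      All (λ q → Γ ⊢ t ∶ proj₂ q) (p ∷ ps) → LinComb t →
      Σ S λ u → TermWeight t u × All (λ q → TypeWeight≈ (proj₂ q) u) (p ∷ ps)
    typed-LinComb-weights (d ∷ []) v with typed-LinComb-weight d v
    ... | u , tm , tw = u , tm , tw ∷ []
    typed-LinComb-weights (d ∷ ds@(_ ∷ _)) v
      with typed-LinComb-weight d v | typed-LinComb-weights ds v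
    ... | _ , tm , tw | _ , tm' , tws rewrite TermWeight-functional tm tm' =
      _ , tm' , tw ∷ tws

mainTheorem14 : ∀ {c ℓ : Level} (R : CommutativeRing c ℓ) →
    let open Lang R in
    let open CommutativeRing R using (_≈_) in
    ∀ (v : Term) (T : GType) → InV v → [] ⊢ v ∶ T →
    Σ S (λ w → Σ S (λ w' → TypeWeight T w × TermWeight v w' × w ≈ w'))
mainTheorem14 R v T (_ , vsum , _) d
  with typed-LinComb-weight d (VSum⇒LinComb vsum)
  where open WeightPreservation R
... | u , tm , (w , tw , w≈u) = w , u , tw , tm , w≈u
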